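{- Let $1\le k<n$, let $A\subset[n]$ with $|A|=k$, and let $i\in[n]\setminus A$. Fix the first $k$ rows $M_k$ of $M_n$ and let the row $k+1$ be random. Then $$\mathbb{P}\left(|\mathrm{Per}(M_{A\cup\{i\}})|\ge |\mathrm{Per}(M_A)|\right)\ge \frac12.$$ Moreover, this bound remains true if one additionally conditions on all entries of row $k+1$ except $a_{k+1,i}$.
   Context: $M_n=(a_{ij})$ is an $n\times n$ random matrix with independent entries, each uniform on $\{ -1,+1\}$; $M_k$ denotes the $k\times n$ matrix formed by its first $k$ rows. For a $k$-element set $A\subset [n]$, $M_A$ denotes the $k\times k$ submatrix of $M_n$ formed by the first $k$ rows and the columns indexed by $A$ (so $M_{A\cup\{i\}}$ uses the first $k+1$ rows). $\mathrm{Per}$ is the permanent $\mathrm{Per}(M)=\sum_{\sigma}\prod_i a_{i\sigma(i)}$. -}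

module Defs where

open import Data.Nat as ℕ using (ℕ; zero; suc; _≤_)
open import Data.Integer as ℤ using (ℤ; +_; -_; 1ℤ; -1ℤ)
open import Data.Bool using (Bool; true; false; _∧_; _∨_; not; if_then_else_)
open import Data.Fin as F using (Fin; zero; suc; inject≤)
open import Data.Fin.Subset using (Subset; inside; outside; ∣_∣)
open import Data.Fin.Subset.Properties using (∣p∣≤n)
open import Data.Vec using ([]; _∷_)
open import Data.List as L using (List; []; _∷_; [_]; concatMap; map; filter; length; allFin)
import Data.Vec.Functional as VF
open import Relation.Nullary using (does; Dec)
open import Data.Bool.ListAction using (and)
open import Data.Sum using (_⊎_)
open import Relation.Binary.PropositionalEquality using (_≡_)
open import Data.Fin.Subset using (_∪_; ⁅_⁆)

elemAt : ∀ {n} (S : Subset n) → Fin ∣ S ∣ → Fin n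
elemAt (inside ∷ S) zero = zero
elemAt (inside ∷ S) (suc j) = suc (elemAt S j)
elemAt (outside ∷ S) j = suc (elemAt S j)

allFuns : (m d : ℕ) → List (Fin m → Fin d)
allFuns zero d = [ (λ ()) ]
allFuns (suc m) d = concatMap (λ f → map (λ x → x VF.∷ f) (allFin d)) (allFuns m d)

isInjective : ∀ {m d} → (Fin m → Fin d) → Bool
isInjective {m} σ =
  and (concatMap (λ a → map (λ b → does (a F.≟ b) ∨ not (does (σ a F.≟ σ b))) (allFin m)) (allFin m))

perms : (m : ℕ) → List (Fin m → Fin m)
perms m = filter (λ σ → Relation.Nullary.Decidable.Core.T? (isInjective σ)) (allFuns m m)
  where import Relation.Nullary.Decidable.Core

prodFin : ∀ m → (Fin m → ℤ) → ℤ
prodFin zero f = 1ℤ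
prodFin (suc m) f = f zero ℤ.* prodFin m (λ j → f (suc j))

sumList : List ℤ → ℤ
sumList = L.foldr ℤ._+_ (+ 0)

Per : ∀ m → (Fin m → Fin m → ℤ) → ℤ
Per m B = sumList (map (λ σ → prodFin m (λ r → B r (σ r))) (perms m))

-- M_S : the ∣S∣ × ∣S∣ submatrix of M formed by the first ∣S∣ rows and the columns in S
sub : ∀ {n} → (Fin n → Fin n → ℤ) → (S : Subset n) → Fin ∣ S ∣ → Fin ∣ S ∣ → ℤ
sub M S r c = M (inject≤ r (∣p∣≤n S)) (elemAt S c)

replaceRow : ∀ {n} → (Fin n → Fin n → ℤ) → Fin n → (Fin n → ℤ) → Fin n → Fin n → ℤ
replaceRow M j x r c = if does (r F.≟ j) then x c else M r c

-- all ±1 vectors of length n (2^n of them, each equally likely)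
signVecs : (n : ℕ) → List (Fin n → ℤ)
signVecs zero = [ (λ ()) ]
signVecs (suc n) = concatMap (λ v → (1ℤ VF.∷ v) ∷ (-1ℤ VF.∷ v) ∷ []) (signVecs n)

setAt : ∀ {n} → (Fin n → ℤ) → Fin n → ℤ → Fin n → ℤ
setAt x i s c = if does (c F.≟ i) then s else x c

IsSign : ℤ → Set
IsSign z = z ≡ 1ℤ ⊎ z ≡ -1ℤ

IsSignMatrix : ∀ {n} → (Fin n → Fin n → ℤ) → Set
IsSignMatrix M = ∀ a b → IsSign (M a b)

Event : ∀ {n} → (Fin n → Fin n → ℤ) → Subset n → Fin n → Set
Event M A i = ℤ.∣ Per _ (sub M A) ∣ ℕ.≤ ℤ.∣ Per _ (sub M (A ∪ ⁅ i ⁆)) ∣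

event? : ∀ {n} (M : Fin n → Fin n → ℤ) (A : Subset n) (i : Fin n) → Dec (Event M A i)
event? M A i = _ ℕ.≤? _

countEvent : ∀ {n} → (Fin n → Fin n → ℤ) → Fin n → Subset n → Fin n → List (Fin n → ℤ) → ℕ
countEvent M j A i xs = length (filter (λ x → event? (replaceRow M j x) A i) xs)

-- Expanding Per(M_{A∪{i}}) along its last row k + 1 shows that it is an affine function of the entry a_{k+1,i}
-- whose slope is the cofactor Per(M_A). So the two choices a_{k+1,i} = ±1 give permanents P₊ and P₋ with
-- P₊ − P₋ = 2 Per(M_A), whence |P₊| + |P₋| ≥ 2 |Per(M_A)| and at least one of them is ≥ |Per(M_A)|. The 2ⁿ sign
-- rows split into pairs differing only in coordinate i, each containing a favourable row: this gives the bound
-- for a uniformly random row k + 1 as well as conditionally on the other entries of that row.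
--
-- Permanents are computed by perOn, the sum over injections of the rows into a set of allowed columns written as
-- an expansion along the first row; expansion along any other row and restriction to the columns of a subset
-- then become inductions.

module Submission where

open import Defs
open import Data.Nat using (ℕ; _≤_; _<_; _*_; _^_)
open import Data.Integer using (ℤ; 1ℤ; -1ℤ)
open import Data.Fin using (Fin; fromℕ<)
open import Data.Fin.Subset using (Subset; ∣_∣; _∉_)
open import Data.List using (_∷_; [])
open import Data.Product using (_×_)
open import Relation.Binary.PropositionalEquality using (_≡_)

open import Data.Product using (_,_)
open import Data.Sum as Sum using (_⊎_; inj₁; inj₂; [_,_])
open import Data.Empty using (⊥-elim)
open import Data.Bool using (Bool; true; false; _∧_; _∨_; not; if_then_else_)
import Data.Bool.Properties as Bool
open import Data.Bool.ListAction using (and)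
import Data.Nat as ℕ
import Data.Nat.Properties as ℕ
import Data.Integer as ℤ
import Data.Integer.Properties as ℤ
open import Data.Integer.Tactic.RingSolver using (solve-∀)
open import Data.Fin using (zero; suc; _≟_; punchIn; toℕ; inject≤; fromℕ)
import Data.Fin.Properties as Fin
open import Data.Fin.Subset using (inside; outside; _∪_; ⁅_⁆)
import Data.Fin.Subset.Properties as Subset
open import Data.List using (List; _++_; map; concatMap; filter; length; tabulate; allFin)
import Data.List.Properties as List
open import Data.Vec using (lookup; _∷_; []; here; there)
open import Data.Vec.Properties using ([]=⇒lookup)
import Data.Vec.Functional as Vector
open import Function using (_∘_; id)
open import Level using (0ℓ)
open import Relation.Nullary using (does; yes; no)
open import Relation.Nullary.Decidable using (dec-true; dec-false; T?)
open import Relation.Unary using (Pred; Decidable)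
open import Relation.Binary.Definitions using (_Respects_)
open import Relation.Binary.PropositionalEquality
  using (refl; sym; trans; cong; cong₂; subst; subst₂; _≢_; _≗_; module ≡-Reasoning)
open import Algebra.Bundles using (CommutativeMonoid)
open import Algebra.Solver.CommutativeMonoid Bool.∧-commutativeMonoid
  using (_⊕_; _⊜_) renaming (solve to ∧-solve)
open import Algebra.Properties.CommutativeSemigroup
  (CommutativeMonoid.commutativeSemigroup Bool.∧-commutativeMonoid) using (interchange; xy∙z≈xz∙y)
open import Algebra.Properties.Semiring.Sum ℤ.+-*-semiring
  using (sum; sum-cong-≗; ∑-distrib-+; *-distribˡ-sum; sum-replicate-zero)

open ≡-Reasoning

-- Finite sums

when : Bool → ℤ → ℤ
when b z = if b then z else ℤ.0ℤ

when-sum : ∀ {d} b (f : Fin d → ℤ) → when b (sum f) ≡ sum (when b ∘ f)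
when-sum true  f = refl
when-sum {d} false f = sym (sum-replicate-zero d)

sum-δ : ∀ {d} (g : Fin d → ℤ) c → (∀ x → x ≢ c → g x ≡ ℤ.0ℤ) → sum g ≡ g c
sum-δ {ℕ.suc d} g zero g≡0 = begin
  g zero ℤ.+ sum (g ∘ suc)
    ≡⟨ cong (λ s → g zero ℤ.+ s) (trans (sum-cong-≗ (λ x → g≡0 (suc x) λ ())) (sum-replicate-zero d)) ⟩
  g zero ℤ.+ ℤ.0ℤ
    ≡⟨ ℤ.+-identityʳ _ ⟩
  g zero ∎
sum-δ g (suc c) g≡0 = begin
  g zero ℤ.+ sum (g ∘ suc)
    ≡⟨ cong₂ ℤ._+_ (g≡0 zero λ ()) (sum-δ (g ∘ suc) c λ x x≢c → g≡0 (suc x) (x≢c ∘ Fin.suc-injective)) ⟩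
  ℤ.0ℤ ℤ.+ g (suc c)
    ≡⟨ ℤ.+-identityˡ _ ⟩
  g (suc c) ∎

sumOver : ∀ {A : Set} → List A → (A → ℤ) → ℤ
sumOver xs g = sumList (map g xs)

sumOver-cong : ∀ {A : Set} (xs : List A) {f g : A → ℤ} → f ≗ g → sumOver xs f ≡ sumOver xs g
sumOver-cong xs f≗g = cong sumList (List.map-cong f≗g xs)

sumOver-filter : ∀ {A : Set} (p : A → Bool) (xs : List A) g →
  sumOver (filter (T? ∘ p) xs) g ≡ sumOver xs (λ a → when (p a) (g a))
sumOver-filter p []       g = refl
sumOver-filter p (x ∷ xs) g with p x
... | true  = cong (λ s → g x ℤ.+ s) (sumOver-filter p xs g)
... | false = trans (sumOver-filter p xs g) (sym (ℤ.+-identityˡ _))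

sumOver-++ : ∀ {A : Set} (xs ys : List A) g → sumOver (xs ++ ys) g ≡ sumOver xs g ℤ.+ sumOver ys g
sumOver-++ []       ys g = sym (ℤ.+-identityˡ _)
sumOver-++ (x ∷ xs) ys g = trans (cong (λ s → g x ℤ.+ s) (sumOver-++ xs ys g)) (sym (ℤ.+-assoc (g x) _ _))

sumOver-concatMap : ∀ {A B : Set} (h : A → List B) (xs : List A) g →
  sumOver (concatMap h xs) g ≡ sumOver xs (λ a → sumOver (h a) g)
sumOver-concatMap h []       g = refl
sumOver-concatMap h (x ∷ xs) g =
  trans (sumOver-++ (h x) (concatMap h xs) g) (cong (λ s → sumOver (h x) g ℤ.+ s) (sumOver-concatMap h xs g))

sumOver-map-tabulate : ∀ {B C : Set} d (t : Fin d → B) (h : B → C) g →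
  sumOver (map h (tabulate t)) g ≡ sum (g ∘ h ∘ t)
sumOver-map-tabulate ℕ.zero    t h g = refl
sumOver-map-tabulate (ℕ.suc d) t h g = cong (λ s → g (h (t zero)) ℤ.+ s) (sumOver-map-tabulate d (t ∘ suc) h g)

sumOver-sum-comm : ∀ {A : Set} (xs : List A) d (g : A → Fin d → ℤ) →
  sumOver xs (λ a → sum (g a)) ≡ sum (λ x → sumOver xs (λ a → g a x))
sumOver-sum-comm []       d g = sym (sum-replicate-zero d)
sumOver-sum-comm (a ∷ xs) d g =
  trans (cong (λ s → sum (g a) ℤ.+ s) (sumOver-sum-comm xs d g)) (sym (∑-distrib-+ (g a) _))

sumOver-when-* : ∀ {A : Set} (xs : List A) b c (g : A → ℤ) →
  sumOver xs (λ a → when b (c ℤ.* g a)) ≡ when b (c ℤ.* sumOver xs g)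
sumOver-when-* []       true  c g = sym (ℤ.*-zeroʳ c)
sumOver-when-* []       false c g = refl
sumOver-when-* (x ∷ xs) true  c g =
  trans (cong (λ s → c ℤ.* g x ℤ.+ s) (sumOver-when-* xs true c g)) (sym (ℤ.*-distribˡ-+ c (g x) _))
sumOver-when-* (x ∷ xs) false c g = trans (ℤ.+-identityˡ _) (sumOver-when-* xs false c g)

sumOver-allFuns : ∀ m d g →
  sumOver (allFuns (ℕ.suc m) d) g ≡ sum (λ x → sumOver (allFuns m d) (λ f → g (x Vector.∷ f)))
sumOver-allFuns m d g = begin
  sumOver (allFuns (ℕ.suc m) d) g
    ≡⟨ sumOver-concatMap (λ f → map (Vector._∷ f) (allFin d)) (allFuns m d) g ⟩
  sumOver (allFuns m d) (λ f → sumOver (map (Vector._∷ f) (allFin d)) g)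
    ≡⟨ sumOver-cong (allFuns m d) (λ f → sumOver-map-tabulate d id (Vector._∷ f) g) ⟩
  sumOver (allFuns m d) (λ f → sum (λ x → g (x Vector.∷ f)))
    ≡⟨ sumOver-sum-comm (allFuns m d) d _ ⟩
  sum (λ x → sumOver (allFuns m d) (λ f → g (x Vector.∷ f))) ∎

-- The injectivity test

allᵇ : ∀ m → (Fin m → Bool) → Bool
allᵇ ℕ.zero    p = true
allᵇ (ℕ.suc m) p = p zero ∧ allᵇ m (p ∘ suc)

allᵇ-cong : ∀ m {p q : Fin m → Bool} → p ≗ q → allᵇ m p ≡ allᵇ m q
allᵇ-cong ℕ.zero    p≗q = refl
allᵇ-cong (ℕ.suc m) p≗q = cong₂ _∧_ (p≗q zero) (allᵇ-cong m (p≗q ∘ suc))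

allᵇ-true : ∀ m → allᵇ m (λ _ → true) ≡ true
allᵇ-true ℕ.zero    = refl
allᵇ-true (ℕ.suc m) = allᵇ-true m

allᵇ-∧ : ∀ m (p q : Fin m → Bool) → allᵇ m (λ x → p x ∧ q x) ≡ allᵇ m p ∧ allᵇ m q
allᵇ-∧ ℕ.zero    p q = refl
allᵇ-∧ (ℕ.suc m) p q =
  trans (cong ((p zero ∧ q zero) ∧_) (allᵇ-∧ m (p ∘ suc) (q ∘ suc))) (interchange (p zero) (q zero) _ _)

and-++ : ∀ (xs ys : List Bool) → and (xs ++ ys) ≡ and xs ∧ and ys
and-++ []       ys = refl
and-++ (x ∷ xs) ys = trans (cong (x ∧_) (and-++ xs ys)) (sym (Bool.∧-assoc x _ _))

and-map-tabulate : ∀ {B : Set} m (t : Fin m → B) (p : B → Bool) → and (map p (tabulate t)) ≡ allᵇ m (p ∘ t)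
and-map-tabulate ℕ.zero    t p = refl
and-map-tabulate (ℕ.suc m) t p = cong (p (t zero) ∧_) (and-map-tabulate m (t ∘ suc) p)

and-concatMap-tabulate : ∀ {B : Set} m (t : Fin m → B) (h : B → List Bool) →
  and (concatMap h (tabulate t)) ≡ allᵇ m (and ∘ h ∘ t)
and-concatMap-tabulate ℕ.zero    t h = refl
and-concatMap-tabulate (ℕ.suc m) t h =
  trans (and-++ (h (t zero)) _) (cong (and (h (t zero)) ∧_) (and-concatMap-tabulate m (t ∘ suc) h))

does-≟-sym : ∀ {d} (x y : Fin d) → does (x ≟ y) ≡ does (y ≟ x)
does-≟-sym x y with x ≟ y
... | yes refl = sym (dec-true (x ≟ x) refl)
... | no x≢y   = sym (dec-false (y ≟ x) (x≢y ∘ sym))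

isInjective-allᵇ : ∀ {m d} (f : Fin m → Fin d) →
  isInjective f ≡ allᵇ m (λ a → allᵇ m (λ b → does (a ≟ b) ∨ not (does (f a ≟ f b))))
isInjective-allᵇ {m} f =
  trans (and-concatMap-tabulate m id _) (allᵇ-cong m (λ a → and-map-tabulate m id _))

avoids : ∀ {m d} → Fin d → (Fin m → Fin d) → Bool
avoids {m} x f = allᵇ m (λ a → not (does (f a ≟ x)))

isInjective-∷ : ∀ {m d} (x : Fin d) (f : Fin m → Fin d) →
  isInjective (x Vector.∷ f) ≡ avoids x f ∧ isInjective f
isInjective-∷ {m} x f = begin
  isInjective (x Vector.∷ f)
    ≡⟨ isInjective-allᵇ (x Vector.∷ f) ⟩
  allᵇ m (λ b → not (does (x ≟ f b))) ∧ allᵇ m (λ a → not (does (f a ≟ x)) ∧ distinct a)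
    ≡⟨ cong₂ _∧_ (allᵇ-cong m (λ b → cong not (does-≟-sym x (f b)))) (allᵇ-∧ m _ distinct) ⟩
  avoids x f ∧ (avoids x f ∧ allᵇ m distinct)
    ≡⟨ sym (Bool.∧-assoc (avoids x f) _ _) ⟩
  (avoids x f ∧ avoids x f) ∧ allᵇ m distinct
    ≡⟨ cong₂ _∧_ (Bool.∧-idem (avoids x f)) (sym (isInjective-allᵇ f)) ⟩
  avoids x f ∧ isInjective f ∎
  where
  distinct : Fin m → Bool
  distinct a = allᵇ m (λ b → does (a ≟ b) ∨ not (does (f a ≟ f b)))

-- Permanents over a set of allowed columns

remove : ∀ {d} → (Fin d → Bool) → Fin d → Fin d → Bool
remove allowed x y = allowed y ∧ not (does (y ≟ x))

perOn : ∀ m {d} → (Fin m → Fin d → ℤ) → (Fin d → Bool) → ℤ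
perOn ℕ.zero    B allowed = 1ℤ
perOn (ℕ.suc m) B allowed = sum (λ x → when (allowed x) (B zero x ℤ.* perOn m (B ∘ suc) (remove allowed x)))

perOn-cong : ∀ m {d} {B B' : Fin m → Fin d → ℤ} {allowed allowed' : Fin d → Bool} →
  (∀ r c → B r c ≡ B' r c) → allowed ≗ allowed' → perOn m B allowed ≡ perOn m B' allowed'
perOn-cong ℕ.zero    B≡B' allowed≗ = refl
perOn-cong (ℕ.suc m) B≡B' allowed≗ = sum-cong-≗ λ x →
  cong₂ when (allowed≗ x) (cong₂ ℤ._*_ (B≡B' zero x)
    (perOn-cong m (B≡B' ∘ suc) (λ c → cong (_∧ not (does (c ≟ x))) (allowed≗ c))))

mapsInto : ∀ {m d} → (Fin d → Bool) → (Fin m → Fin d) → Bool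
mapsInto {m} allowed f = allᵇ m (allowed ∘ f)

injectionSum : ∀ m d → (Fin m → Fin d → ℤ) → (Fin d → Bool) → ℤ
injectionSum m d B allowed =
  sumOver (allFuns m d) (λ f → when (isInjective f ∧ mapsInto allowed f) (prodFin m (λ r → B r (f r))))

isInjective-mapsInto-∷ : ∀ {m d} (allowed : Fin d → Bool) x (f : Fin m → Fin d) →
  isInjective (x Vector.∷ f) ∧ mapsInto allowed (x Vector.∷ f)
    ≡ allowed x ∧ (isInjective f ∧ mapsInto (remove allowed x) f)
isInjective-mapsInto-∷ {m} allowed x f = begin
  isInjective (x Vector.∷ f) ∧ (allowed x ∧ mapsInto allowed f)
    ≡⟨ cong (_∧ (allowed x ∧ mapsInto allowed f)) (isInjective-∷ x f) ⟩
  (avoids x f ∧ isInjective f) ∧ (allowed x ∧ mapsInto allowed f)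
    ≡⟨ ∧-solve 4 (λ a i b c → (a ⊕ i) ⊕ (b ⊕ c) ⊜ b ⊕ (i ⊕ (c ⊕ a))) refl
         (avoids x f) (isInjective f) (allowed x) (mapsInto allowed f) ⟩
  allowed x ∧ (isInjective f ∧ (mapsInto allowed f ∧ avoids x f))
    ≡⟨ cong (λ b → allowed x ∧ (isInjective f ∧ b)) (sym (allᵇ-∧ m _ _)) ⟩
  allowed x ∧ (isInjective f ∧ mapsInto (remove allowed x) f) ∎

injectionSum-suc : ∀ m d B (allowed : Fin d → Bool) →
  injectionSum (ℕ.suc m) d B allowed
    ≡ sum (λ x → when (allowed x) (B zero x ℤ.* injectionSum m d (B ∘ suc) (remove allowed x)))
injectionSum-suc m d B allowed = begin
  injectionSum (ℕ.suc m) d B allowed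
    ≡⟨ sumOver-allFuns m d _ ⟩
  sum (λ x → sumOver (allFuns m d) (λ f → term (x Vector.∷ f)))
    ≡⟨ sum-cong-≗ (λ x → sumOver-cong (allFuns m d) (term-∷ x)) ⟩
  sum (λ x → sumOver (allFuns m d) (λ f → when (allowed x) (B zero x ℤ.* rest x f)))
    ≡⟨ sum-cong-≗ (λ x → sumOver-when-* (allFuns m d) (allowed x) (B zero x) (rest x)) ⟩
  sum (λ x → when (allowed x) (B zero x ℤ.* injectionSum m d (B ∘ suc) (remove allowed x))) ∎
  where
  term : (Fin (ℕ.suc m) → Fin d) → ℤ
  term f = when (isInjective f ∧ mapsInto allowed f) (prodFin (ℕ.suc m) (λ r → B r (f r)))
  rest : Fin d → (Fin m → Fin d) → ℤ
  rest x f = when (isInjective f ∧ mapsInto (remove allowed x) f) (prodFin m (λ r → B (suc r) (f r)))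
  when-∧-* : ∀ a b c (p : ℤ) → when (a ∧ b) (c ℤ.* p) ≡ when a (c ℤ.* when b p)
  when-∧-* true  true  c p = refl
  when-∧-* true  false c p = sym (ℤ.*-zeroʳ c)
  when-∧-* false b     c p = refl
  term-∷ : ∀ x f → term (x Vector.∷ f) ≡ when (allowed x) (B zero x ℤ.* rest x f)
  term-∷ x f = trans (cong (λ b → when b (B zero x ℤ.* prodFin m (λ r → B (suc r) (f r))))
                             (isInjective-mapsInto-∷ allowed x f))
                     (when-∧-* (allowed x) _ (B zero x) _)

injectionSum≡perOn : ∀ m d B (allowed : Fin d → Bool) → injectionSum m d B allowed ≡ perOn m B allowed
injectionSum≡perOn ℕ.zero    d B allowed = refl
injectionSum≡perOn (ℕ.suc m) d B allowed = trans (injectionSum-suc m d B allowed) (sum-cong-≗ λ x →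
  cong (λ p → when (allowed x) (B zero x ℤ.* p)) (injectionSum≡perOn m d (B ∘ suc) (remove allowed x)))

Per≡perOn : ∀ m B → Per m B ≡ perOn m B (λ _ → true)
Per≡perOn m B = begin
  Per m B
    ≡⟨ sumOver-filter isInjective (allFuns m m) _ ⟩
  sumOver (allFuns m m) (λ f → when (isInjective f) (prodFin m (λ r → B r (f r))))
    ≡⟨ sumOver-cong (allFuns m m) (λ f → cong (λ b → when b (prodFin m (λ r → B r (f r)))) (injective-onto-all f)) ⟩
  injectionSum m m B (λ _ → true)
    ≡⟨ injectionSum≡perOn m m B _ ⟩
  perOn m B (λ _ → true) ∎
  where
  injective-onto-all : ∀ f → isInjective f ≡ isInjective f ∧ mapsInto (λ _ → true) f
  injective-onto-all f = sym (trans (cong (isInjective f ∧_) (allᵇ-true m)) (Bool.∧-identityʳ _))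

-- Expansion along a row

remove-comm : ∀ {d} (allowed : Fin d → Bool) x y → remove (remove allowed x) y ≗ remove (remove allowed y) x
remove-comm allowed x y c = xy∙z≈xz∙y (allowed c) (not (does (c ≟ x))) (not (does (c ≟ y)))

when-exchange : ∀ a c e (p u D W : ℤ) →
  when a (p ℤ.* (u ℤ.+ when (c ∧ not e) (D ℤ.* W)))
    ≡ when a (p ℤ.* u) ℤ.+ when c (D ℤ.* when (a ∧ not e) (p ℤ.* W))
when-exchange true  true  false = ring-identity
  where
  ring-identity : ∀ p u D W → p ℤ.* (u ℤ.+ D ℤ.* W) ≡ p ℤ.* u ℤ.+ D ℤ.* (p ℤ.* W)
  ring-identity = solve-∀
when-exchange true  true  true  = ring-identity
  where
  ring-identity : ∀ p u D (W : ℤ) → p ℤ.* (u ℤ.+ ℤ.0ℤ) ≡ p ℤ.* u ℤ.+ D ℤ.* ℤ.0ℤ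
  ring-identity = solve-∀
when-exchange true  false e     = ring-identity
  where
  ring-identity : ∀ p u (D W : ℤ) → p ℤ.* (u ℤ.+ ℤ.0ℤ) ≡ p ℤ.* u ℤ.+ ℤ.0ℤ
  ring-identity = solve-∀
when-exchange false true  e     = ring-identity
  where
  ring-identity : ∀ (p u : ℤ) D (W : ℤ) → ℤ.0ℤ ≡ ℤ.0ℤ ℤ.+ D ℤ.* ℤ.0ℤ
  ring-identity = solve-∀
when-exchange false false e     = λ _ _ _ _ → refl

perOn-cofactor : ∀ m {d} (B B' : Fin (ℕ.suc m) → Fin d → ℤ) (allowed : Fin d → Bool) r₀ c₀ →
  (∀ r → r ≢ r₀ → ∀ c → B r c ≡ B' r c) → (∀ c → c ≢ c₀ → B r₀ c ≡ B' r₀ c) →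
  perOn (ℕ.suc m) B allowed
    ≡ perOn (ℕ.suc m) B' allowed
      ℤ.+ when (allowed c₀) ((B r₀ c₀ ℤ.- B' r₀ c₀) ℤ.* perOn m (B ∘ punchIn r₀) (remove allowed c₀))
perOn-cofactor m {d} B B' allowed zero c₀ same-rows same-row₀ = begin
  sum (λ x → when (allowed x) (B zero x ℤ.* minor B x))
    ≡⟨ sum-cong-≗ split ⟩
  sum (λ x → when (allowed x) (B' zero x ℤ.* minor B' x) ℤ.+ δ x)
    ≡⟨ ∑-distrib-+ _ δ ⟩
  perOn (ℕ.suc m) B' allowed ℤ.+ sum δ
    ≡⟨ cong (λ s → perOn (ℕ.suc m) B' allowed ℤ.+ s) (sum-δ δ c₀ δ-vanishes) ⟩
  perOn (ℕ.suc m) B' allowed ℤ.+ δ c₀ ∎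
  where
  minor : (Fin (ℕ.suc m) → Fin d → ℤ) → Fin d → ℤ
  minor C x = perOn m (C ∘ suc) (remove allowed x)
  δ : Fin d → ℤ
  δ x = when (allowed x) ((B zero x ℤ.- B' zero x) ℤ.* minor B x)
  same-minor : ∀ x → minor B x ≡ minor B' x
  same-minor x = perOn-cong m (λ r → same-rows (suc r) λ ()) (λ _ → refl)
  split : ∀ x → when (allowed x) (B zero x ℤ.* minor B x) ≡ when (allowed x) (B' zero x ℤ.* minor B' x) ℤ.+ δ x
  split x with allowed x
  ... | true  = trans (ring-identity (B zero x) (B' zero x) (minor B x))
                      (cong (λ w → B' zero x ℤ.* w ℤ.+ (B zero x ℤ.- B' zero x) ℤ.* minor B x) (same-minor x))
    where
    ring-identity : ∀ b b' w → b ℤ.* w ≡ b' ℤ.* w ℤ.+ (b ℤ.- b') ℤ.* w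
    ring-identity = solve-∀
  ... | false = refl
  δ-vanishes : ∀ x → x ≢ c₀ → δ x ≡ ℤ.0ℤ
  δ-vanishes x x≢c₀ with allowed x
  ... | true  = cong (ℤ._* minor B x) (ℤ.i≡j⇒i-j≡0 (same-row₀ x x≢c₀))
  ... | false = refl
-- Expand along row 0, use the induction hypothesis on the minors, then exchange the column x of row 0 with the
-- column c₀ of row r₀.
perOn-cofactor (ℕ.suc m) {d} B B' allowed (suc r₀) c₀ same-rows same-row₀ = begin
  sum (λ x → when (allowed x) (B zero x ℤ.* perOn (ℕ.suc m) (B ∘ suc) (remove allowed x)))
    ≡⟨ sum-cong-≗ (λ x → cong (λ p → when (allowed x) (B zero x ℤ.* p)) (lower x)) ⟩
  sum (λ x → when (allowed x) (B zero x ℤ.* (minor′ x ℤ.+ when (remove allowed x c₀) (D ℤ.* W x))))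
    ≡⟨ sum-cong-≗ exchange ⟩
  sum (λ x → when (allowed x) (B' zero x ℤ.* minor′ x) ℤ.+ when (allowed c₀) (D ℤ.* G x))
    ≡⟨ ∑-distrib-+ (λ x → when (allowed x) (B' zero x ℤ.* minor′ x)) (λ x → when (allowed c₀) (D ℤ.* G x)) ⟩
  perOn (ℕ.suc (ℕ.suc m)) B' allowed ℤ.+ sum (λ x → when (allowed c₀) (D ℤ.* G x))
    ≡⟨ cong (λ s → perOn (ℕ.suc (ℕ.suc m)) B' allowed ℤ.+ s) (sym (pull-out (allowed c₀))) ⟩
  perOn (ℕ.suc (ℕ.suc m)) B' allowed ℤ.+ when (allowed c₀) (D ℤ.* sum G) ∎
  where
  D : ℤ
  D = B (suc r₀) c₀ ℤ.- B' (suc r₀) c₀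
  Q : (Fin d → Bool) → ℤ
  Q = perOn m (B ∘ suc ∘ punchIn r₀)
  minor′ : Fin d → ℤ
  minor′ x = perOn (ℕ.suc m) (B' ∘ suc) (remove allowed x)
  W : Fin d → ℤ
  W x = Q (remove (remove allowed x) c₀)
  G : Fin d → ℤ
  G x = when (remove allowed c₀ x) (B zero x ℤ.* Q (remove (remove allowed c₀) x))
  lower : ∀ x → perOn (ℕ.suc m) (B ∘ suc) (remove allowed x) ≡ minor′ x ℤ.+ when (remove allowed x c₀) (D ℤ.* W x)
  lower x = perOn-cofactor m (B ∘ suc) (B' ∘ suc) (remove allowed x) r₀ c₀
    (λ r r≢r₀ → same-rows (suc r) (r≢r₀ ∘ Fin.suc-injective)) same-row₀
  exchange : ∀ x → when (allowed x) (B zero x ℤ.* (minor′ x ℤ.+ when (remove allowed x c₀) (D ℤ.* W x)))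
                 ≡ when (allowed x) (B' zero x ℤ.* minor′ x) ℤ.+ when (allowed c₀) (D ℤ.* G x)
  exchange x = begin
    when (allowed x) (B zero x ℤ.* (minor′ x ℤ.+ when (allowed c₀ ∧ not (does (c₀ ≟ x))) (D ℤ.* W x)))
      ≡⟨ cong (λ e → when (allowed x) (B zero x ℤ.* (minor′ x ℤ.+ when (allowed c₀ ∧ not e) (D ℤ.* W x))))
              (does-≟-sym c₀ x) ⟩
    when (allowed x) (B zero x ℤ.* (minor′ x ℤ.+ when (allowed c₀ ∧ not (does (x ≟ c₀))) (D ℤ.* W x)))
      ≡⟨ when-exchange (allowed x) (allowed c₀) (does (x ≟ c₀)) (B zero x) (minor′ x) D (W x) ⟩
    when (allowed x) (B zero x ℤ.* minor′ x)
      ℤ.+ when (allowed c₀) (D ℤ.* when (remove allowed c₀ x) (B zero x ℤ.* W x))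
      ≡⟨ cong₂ (λ b w → when (allowed x) (b ℤ.* minor′ x)
                        ℤ.+ when (allowed c₀) (D ℤ.* when (remove allowed c₀ x) (B zero x ℤ.* w)))
              (same-rows zero (λ ()) x) (perOn-cong m (λ _ _ → refl) (remove-comm allowed x c₀)) ⟩
    when (allowed x) (B' zero x ℤ.* minor′ x) ℤ.+ when (allowed c₀) (D ℤ.* G x) ∎
  pull-out : ∀ a → when a (D ℤ.* sum G) ≡ sum (λ x → when a (D ℤ.* G x))
  pull-out a = trans (cong (when a) (*-distribˡ-sum D G)) (when-sum a (λ x → D ℤ.* G x))

-- Column selection

scatter : ∀ {n} (S : Subset n) → (Fin ∣ S ∣ → Bool) → Fin n → Bool
scatter (inside  ∷ S) allowed zero    = allowed zero
scatter (inside  ∷ S) allowed (suc y) = scatter S (allowed ∘ suc) y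
scatter (outside ∷ S) allowed zero    = false
scatter (outside ∷ S) allowed (suc y) = scatter S allowed y

scatter-cong : ∀ {n} (S : Subset n) {allowed allowed'} → allowed ≗ allowed' → scatter S allowed ≗ scatter S allowed'
scatter-cong (inside  ∷ S) eq zero    = eq zero
scatter-cong (inside  ∷ S) eq (suc y) = scatter-cong S (eq ∘ suc) y
scatter-cong (outside ∷ S) eq zero    = refl
scatter-cong (outside ∷ S) eq (suc y) = scatter-cong S eq y

scatter-elemAt : ∀ {n} (S : Subset n) allowed x → scatter S allowed (elemAt S x) ≡ allowed x
scatter-elemAt (inside  ∷ S) allowed zero    = refl
scatter-elemAt (inside  ∷ S) allowed (suc x) = scatter-elemAt S (allowed ∘ suc) x
scatter-elemAt (outside ∷ S) allowed x       = scatter-elemAt S allowed x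

scatter-outside : ∀ {n} (S : Subset n) allowed y → lookup S y ≡ outside → scatter S allowed y ≡ false
scatter-outside (outside ∷ S) allowed zero    _   = refl
scatter-outside (inside  ∷ S) allowed (suc y) y∉S = scatter-outside S (allowed ∘ suc) y y∉S
scatter-outside (outside ∷ S) allowed (suc y) y∉S = scatter-outside S allowed y y∉S

scatter-true : ∀ {n} (S : Subset n) → scatter S (λ _ → true) ≗ lookup S
scatter-true (inside  ∷ S) zero    = refl
scatter-true (inside  ∷ S) (suc y) = scatter-true S y
scatter-true (outside ∷ S) zero    = refl
scatter-true (outside ∷ S) (suc y) = scatter-true S y

scatter-remove : ∀ {n} (S : Subset n) allowed x →
  scatter S (remove allowed x) ≗ remove (scatter S allowed) (elemAt S x)
scatter-remove (inside  ∷ S) allowed zero    zero    = refl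
scatter-remove (inside  ∷ S) allowed zero    (suc y) =
  trans (scatter-cong S (λ j → Bool.∧-identityʳ (allowed (suc j))) y) (sym (Bool.∧-identityʳ _))
scatter-remove (inside  ∷ S) allowed (suc x) zero    = refl
scatter-remove (inside  ∷ S) allowed (suc x) (suc y) = scatter-remove S (allowed ∘ suc) x y
scatter-remove (outside ∷ S) allowed x       zero    = refl
scatter-remove (outside ∷ S) allowed x       (suc y) = scatter-remove S allowed x y

sum-elemAt : ∀ {n} (S : Subset n) (g : Fin n → ℤ) → (∀ y → lookup S y ≡ outside → g y ≡ ℤ.0ℤ) →
  sum g ≡ sum (g ∘ elemAt S)
sum-elemAt []            g g≡0 = refl
sum-elemAt (inside  ∷ S) g g≡0 = cong (λ s → g zero ℤ.+ s) (sum-elemAt S (g ∘ suc) (g≡0 ∘ suc))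
sum-elemAt (outside ∷ S) g g≡0 =
  trans (cong (ℤ._+ sum (g ∘ suc)) (g≡0 zero refl)) (trans (ℤ.+-identityˡ _) (sum-elemAt S (g ∘ suc) (g≡0 ∘ suc)))

perOn-elemAt : ∀ p {n} (S : Subset n) (B : Fin p → Fin n → ℤ) allowed →
  perOn p (λ r c → B r (elemAt S c)) allowed ≡ perOn p B (scatter S allowed)
perOn-elemAt ℕ.zero    S B allowed = refl
perOn-elemAt (ℕ.suc p) {n} S B allowed = begin
  sum (λ x → when (allowed x) (B zero (elemAt S x) ℤ.* perOn p (λ r c → B (suc r) (elemAt S c)) (remove allowed x)))
    ≡⟨ sum-cong-≗ (λ x → cong₂ (λ a q → when a (B zero (elemAt S x) ℤ.* q)) (sym (scatter-elemAt S allowed x))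
         (trans (perOn-elemAt p S (B ∘ suc) (remove allowed x))
                (perOn-cong p (λ _ _ → refl) (scatter-remove S allowed x)))) ⟩
  sum (term ∘ elemAt S)
    ≡⟨ sum-elemAt S term (λ y y∉S → cong (λ a → when a (B zero y ℤ.* minor y)) (scatter-outside S allowed y y∉S)) ⟨
  sum term ∎
  where
  minor : Fin n → ℤ
  minor y = perOn p (B ∘ suc) (remove (scatter S allowed) y)
  term : Fin n → ℤ
  term y = when (scatter S allowed y) (B zero y ℤ.* minor y)

∣p∪⁅x⁆∣≡1+∣p∣ : ∀ {n} (p : Subset n) x → x ∉ p → ∣ p ∪ ⁅ x ⁆ ∣ ≡ ℕ.suc ∣ p ∣
∣p∪⁅x⁆∣≡1+∣p∣ (inside  ∷ p) zero    x∉p = ⊥-elim (x∉p here)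
∣p∪⁅x⁆∣≡1+∣p∣ (outside ∷ p) zero    x∉p = cong (ℕ.suc ∘ ∣_∣) (Subset.∪-identityʳ p)
∣p∪⁅x⁆∣≡1+∣p∣ (inside  ∷ p) (suc x) x∉p = cong ℕ.suc (∣p∪⁅x⁆∣≡1+∣p∣ p x (x∉p ∘ there))
∣p∪⁅x⁆∣≡1+∣p∣ (outside ∷ p) (suc x) x∉p = ∣p∪⁅x⁆∣≡1+∣p∣ p x (x∉p ∘ there)

lookup-p∪⁅x⁆-x : ∀ {n} (p : Subset n) x → lookup (p ∪ ⁅ x ⁆) x ≡ inside
lookup-p∪⁅x⁆-x p x = []=⇒lookup (Subset.q⊆p∪q p ⁅ x ⁆ (Subset.x∈⁅x⁆ x))

remove-p∪⁅x⁆ : ∀ {n} (p : Subset n) x → x ∉ p → remove (lookup (p ∪ ⁅ x ⁆)) x ≗ lookup p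
remove-p∪⁅x⁆ (inside  ∷ p) zero    x∉p _       = ⊥-elim (x∉p here)
remove-p∪⁅x⁆ (outside ∷ p) zero    x∉p zero    = refl
remove-p∪⁅x⁆ (outside ∷ p) zero    x∉p (suc y) =
  trans (Bool.∧-identityʳ _) (cong (λ q → lookup q y) (Subset.∪-identityʳ p))
remove-p∪⁅x⁆ (b ∷ p)       (suc x) x∉p zero    = trans (Bool.∧-identityʳ _) (Bool.∨-identityʳ b)
remove-p∪⁅x⁆ (b ∷ p)       (suc x) x∉p (suc y) = remove-p∪⁅x⁆ p x (x∉p ∘ there) y

-- Submatrices and the row k + 1

firstRows : ∀ {q n} → .(q ≤ n) → (Fin n → Fin n → ℤ) → Fin q → Fin n → ℤ
firstRows q≤n M r = M (inject≤ r q≤n)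

Per-cong : ∀ m (B B' : Fin m → Fin m → ℤ) → (∀ r c → B r c ≡ B' r c) → Per m B ≡ Per m B'
Per-cong m B B' B≡B' = trans (Per≡perOn m B) (trans (perOn-cong m B≡B' (λ _ → refl)) (sym (Per≡perOn m B')))

Per-sub : ∀ {n} (M : Fin n → Fin n → ℤ) (S : Subset n) →
  Per (∣ S ∣) (sub M S) ≡ perOn (∣ S ∣) (firstRows (Subset.∣p∣≤n S) M) (lookup S)
Per-sub M S = begin
  Per (∣ S ∣) (sub M S)
    ≡⟨ Per≡perOn (∣ S ∣) (sub M S) ⟩
  perOn (∣ S ∣) (sub M S) (λ _ → true)
    ≡⟨ perOn-elemAt (∣ S ∣) S _ _ ⟩
  perOn (∣ S ∣) (firstRows (Subset.∣p∣≤n S) M) (scatter S (λ _ → true))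
    ≡⟨ perOn-cong (∣ S ∣) (λ _ _ → refl) (scatter-true S) ⟩
  perOn (∣ S ∣) (firstRows (Subset.∣p∣≤n S) M) (lookup S) ∎

replaceRow-same : ∀ {n} (M : Fin n → Fin n → ℤ) j v c → replaceRow M j v j c ≡ v c
replaceRow-same M j v c rewrite dec-true (j ≟ j) refl = refl

replaceRow-other : ∀ {n} (M : Fin n → Fin n → ℤ) {j} v {r} c → r ≢ j → replaceRow M j v r c ≡ M r c
replaceRow-other M {j} v {r} c r≢j rewrite dec-false (r ≟ j) r≢j = refl

setAt-same : ∀ {n} (x : Fin n → ℤ) i s → setAt x i s i ≡ s
setAt-same x i s rewrite dec-true (i ≟ i) refl = refl

setAt-other : ∀ {n} (x : Fin n → ℤ) {i} s {c} → c ≢ i → setAt x i s c ≡ x c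
setAt-other x {i} s {c} c≢i rewrite dec-false (c ≟ i) c≢i = refl

inject≤≢fromℕ< : ∀ {q n k} (r : Fin q) .(q≤n : q ≤ n) (k<n : k < n) → toℕ r ≢ k → inject≤ r q≤n ≢ fromℕ< k<n
inject≤≢fromℕ< r q≤n k<n r≢k eq = r≢k (begin
  toℕ r                ≡⟨ Fin.toℕ-inject≤ r q≤n ⟨
  toℕ (inject≤ r q≤n)  ≡⟨ cong toℕ eq ⟩
  toℕ (fromℕ< k<n)     ≡⟨ Fin.toℕ-fromℕ< k<n ⟩
  _                    ∎)

firstRows-replaceRow : ∀ {q n k} (q≤n : q ≤ n) (M : Fin n → Fin n → ℤ) (k<n : k < n) v → q ≤ k →
  ∀ r c → firstRows q≤n (replaceRow M (fromℕ< k<n) v) r c ≡ firstRows q≤n M r c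
firstRows-replaceRow q≤n M k<n v q≤k r c = replaceRow-other M v c
  (inject≤≢fromℕ< r q≤n k<n λ r≡k → ℕ.<⇒≢ (ℕ.<-≤-trans (Fin.toℕ<n r) q≤k) r≡k)

Per-sub-replaceRow : ∀ {n k} (M : Fin n → Fin n → ℤ) (k<n : k < n) v (S : Subset n) → (∣ S ∣) ≤ k →
  Per (∣ S ∣) (sub (replaceRow M (fromℕ< k<n) v) S) ≡ Per (∣ S ∣) (sub M S)
Per-sub-replaceRow M k<n v S ∣S∣≤k = Per-cong (∣ S ∣) _ _ λ r c →
  firstRows-replaceRow (Subset.∣p∣≤n S) M k<n v ∣S∣≤k r (elemAt S c)

toℕ-punchIn-fromℕ : ∀ k (r : Fin k) → toℕ (punchIn (fromℕ k) r) ≡ toℕ r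
toℕ-punchIn-fromℕ (ℕ.suc k) zero    = refl
toℕ-punchIn-fromℕ (ℕ.suc k) (suc r) = cong ℕ.suc (toℕ-punchIn-fromℕ k r)

perOn-flip : ∀ {n k} (M : Fin n → Fin n → ℤ) (k<n : k < n) (i : Fin n) (x : Fin n → ℤ) (allowed : Fin n → Bool) →
  allowed i ≡ true →
  let N = λ s → firstRows k<n (replaceRow M (fromℕ< k<n) (setAt x i s)) in
  perOn (ℕ.suc k) (N 1ℤ) allowed
    ≡ perOn (ℕ.suc k) (N -1ℤ) allowed ℤ.+ ℤ.+ 2 ℤ.* perOn k (firstRows (ℕ.<⇒≤ k<n) M) (remove allowed i)
perOn-flip {n} {k} M k<n i x allowed i-allowed = begin
  perOn (ℕ.suc k) (N 1ℤ) allowed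
    ≡⟨ perOn-cofactor k (N 1ℤ) (N -1ℤ) allowed (fromℕ k) i same-rows same-last-row ⟩
  perOn (ℕ.suc k) (N -1ℤ) allowed
    ℤ.+ when (allowed i) cofactor
    ≡⟨ cong (λ b → perOn (ℕ.suc k) (N -1ℤ) allowed ℤ.+ when b cofactor) i-allowed ⟩
  perOn (ℕ.suc k) (N -1ℤ) allowed ℤ.+ cofactor
    ≡⟨ cong (λ t → perOn (ℕ.suc k) (N -1ℤ) allowed ℤ.+ t)
         (cong₂ ℤ._*_ entry-difference (perOn-cong k minor (λ _ → refl))) ⟩
  perOn (ℕ.suc k) (N -1ℤ) allowed ℤ.+ ℤ.+ 2 ℤ.* perOn k (firstRows (ℕ.<⇒≤ k<n) M) (remove allowed i) ∎
  where
  N : ℤ → Fin (ℕ.suc k) → Fin n → ℤ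
  N s = firstRows k<n (replaceRow M (fromℕ< k<n) (setAt x i s))
  cofactor : ℤ
  cofactor = (N 1ℤ (fromℕ k) i ℤ.- N -1ℤ (fromℕ k) i) ℤ.* perOn k (N 1ℤ ∘ punchIn (fromℕ k)) (remove allowed i)
  last-row : ∀ s c → N s (fromℕ k) c ≡ setAt x i s c
  last-row s c = trans (cong (λ r → replaceRow M (fromℕ< k<n) (setAt x i s) r c)
                         (Fin.toℕ-injective (trans (Fin.toℕ-inject≤ (fromℕ k) k<n)
                                              (trans (Fin.toℕ-fromℕ k) (sym (Fin.toℕ-fromℕ< k<n))))))
                   (replaceRow-same M (fromℕ< k<n) (setAt x i s) c)
  above : ∀ s r → r ≢ fromℕ k → ∀ c → N s r c ≡ M (inject≤ r k<n) c
  above s r r≢k c = replaceRow-other M (setAt x i s) c (inject≤≢fromℕ< r k<n k<n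
    λ r≡k → r≢k (Fin.toℕ-injective (trans r≡k (sym (Fin.toℕ-fromℕ k)))))
  same-rows : ∀ r → r ≢ fromℕ k → ∀ c → N 1ℤ r c ≡ N -1ℤ r c
  same-rows r r≢k c = trans (above 1ℤ r r≢k c) (sym (above -1ℤ r r≢k c))
  same-last-row : ∀ c → c ≢ i → N 1ℤ (fromℕ k) c ≡ N -1ℤ (fromℕ k) c
  same-last-row c c≢i =
    trans (last-row 1ℤ c) (trans (setAt-other x 1ℤ c≢i) (sym (trans (last-row -1ℤ c) (setAt-other x -1ℤ c≢i))))
  entry-difference : N 1ℤ (fromℕ k) i ℤ.- N -1ℤ (fromℕ k) i ≡ ℤ.+ 2
  entry-difference =
    cong₂ ℤ._-_ (trans (last-row 1ℤ i) (setAt-same x i 1ℤ)) (trans (last-row -1ℤ i) (setAt-same x i -1ℤ))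
  minor : ∀ r c → N 1ℤ (punchIn (fromℕ k) r) c ≡ firstRows (ℕ.<⇒≤ k<n) M r c
  minor r c = trans (above 1ℤ (punchIn (fromℕ k) r) (Fin.punchInᵢ≢i (fromℕ k) r) c)
                    (cong (λ r′ → M r′ c) (Fin.toℕ-injective (begin
                      toℕ (inject≤ (punchIn (fromℕ k) r) k<n)  ≡⟨ Fin.toℕ-inject≤ _ k<n ⟩
                      toℕ (punchIn (fromℕ k) r)                ≡⟨ toℕ-punchIn-fromℕ k r ⟩
                      toℕ r                                    ≡⟨ Fin.toℕ-inject≤ r (ℕ.<⇒≤ k<n) ⟨
                      toℕ (inject≤ r (ℕ.<⇒≤ k<n))              ∎)))

Per-flip : ∀ {n} (M : Fin n → Fin n → ℤ) (A : Subset n) (k<n : ∣ A ∣ < n) i → i ∉ A → (x : Fin n → ℤ) →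
  Per _ (sub (replaceRow M (fromℕ< k<n) (setAt x i 1ℤ)) (A ∪ ⁅ i ⁆))
    ≡ Per _ (sub (replaceRow M (fromℕ< k<n) (setAt x i -1ℤ)) (A ∪ ⁅ i ⁆)) ℤ.+ ℤ.+ 2 ℤ.* Per _ (sub M A)
Per-flip {n} M A k<n i i∉A x = begin
  Per _ (sub (N 1ℤ) S)
    ≡⟨ Per-sub (N 1ℤ) S ⟩
  perOn (∣ S ∣) (firstRows (Subset.∣p∣≤n S) (N 1ℤ)) (lookup S)
    ≡⟨ flip (∣ S ∣) (Subset.∣p∣≤n S) (∣p∪⁅x⁆∣≡1+∣p∣ A i i∉A) ⟩
  perOn (∣ S ∣) (firstRows (Subset.∣p∣≤n S) (N -1ℤ)) (lookup S) ℤ.+ ℤ.+ 2 ℤ.* perOn-A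
    ≡⟨ cong₂ (λ a p → a ℤ.+ ℤ.+ 2 ℤ.* p) (Per-sub (N -1ℤ) S) (Per-sub M A) ⟨
  Per _ (sub (N -1ℤ) S) ℤ.+ ℤ.+ 2 ℤ.* Per _ (sub M A) ∎
  where
  S : Subset n
  S = A ∪ ⁅ i ⁆
  perOn-A : ℤ
  perOn-A = perOn (∣ A ∣) (firstRows (Subset.∣p∣≤n A) M) (lookup A)
  N : ℤ → Fin n → Fin n → ℤ
  N s = replaceRow M (fromℕ< k<n) (setAt x i s)
  -- ∣ S ∣ is only propositionally equal to 1 + ∣ A ∣, so we abstract over it.
  flip : ∀ q (q≤n : q ≤ n) → q ≡ ℕ.suc ∣ A ∣ →
    perOn q (firstRows q≤n (N 1ℤ)) (lookup S)
      ≡ perOn q (firstRows q≤n (N -1ℤ)) (lookup S) ℤ.+ ℤ.+ 2 ℤ.* perOn-A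
  flip _ q≤n refl = trans (perOn-flip M k<n i x (lookup S) (lookup-p∪⁅x⁆-x A i))
    (cong (λ p → perOn _ (firstRows q≤n (N -1ℤ)) (lookup S) ℤ.+ ℤ.+ 2 ℤ.* p)
          (perOn-cong (∣ A ∣) {B = firstRows (ℕ.<⇒≤ k<n) M} (λ _ _ → refl) (remove-p∪⁅x⁆ A i i∉A)))

∣p∣≤∣a∣⊎∣p∣≤∣b∣ : ∀ a b p → a ≡ b ℤ.+ ℤ.+ 2 ℤ.* p → ℤ.∣ p ∣ ≤ ℤ.∣ a ∣ ⊎ ℤ.∣ p ∣ ≤ ℤ.∣ b ∣
∣p∣≤∣a∣⊎∣p∣≤∣b∣ a b p a≡b+2p with ℤ.∣ p ∣ ℕ.≤? ℤ.∣ a ∣ | ℤ.∣ p ∣ ℕ.≤? ℤ.∣ b ∣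
... | yes p≤a | _       = inj₁ p≤a
... | no  _   | yes p≤b = inj₂ p≤b
... | no  p≰a | no  p≰b = ⊥-elim (ℕ.<-irrefl refl
      (ℕ.<-≤-trans (ℕ.+-mono-< (ℕ.≰⇒> p≰a) (ℕ.≰⇒> p≰b)) (ℕ.≤-trans (ℕ.≤-reflexive 2∣p∣≡∣a-b∣) (ℤ.∣i-j∣≤∣i∣+∣j∣ a b))))
  where
  a-b≡2p : ∀ b p → (b ℤ.+ ℤ.+ 2 ℤ.* p) ℤ.- b ≡ ℤ.+ 2 ℤ.* p
  a-b≡2p = solve-∀
  2∣p∣≡∣a-b∣ : ℤ.∣ p ∣ ℕ.+ ℤ.∣ p ∣ ≡ ℤ.∣ a ℤ.- b ∣
  2∣p∣≡∣a-b∣ = begin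
    ℤ.∣ p ∣ ℕ.+ ℤ.∣ p ∣        ≡⟨ cong (ℤ.∣ p ∣ ℕ.+_) (ℕ.+-identityʳ _) ⟨
    2 * ℤ.∣ p ∣               ≡⟨ ℤ.∣i*j∣≡∣i∣*∣j∣ (ℤ.+ 2) p ⟨
    ℤ.∣ ℤ.+ 2 ℤ.* p ∣         ≡⟨ cong ℤ.∣_∣ (trans (cong (ℤ._- b) a≡b+2p) (a-b≡2p b p)) ⟨
    ℤ.∣ a ℤ.- b ∣             ∎

replaceRow-cong : ∀ {n} (M : Fin n → Fin n → ℤ) j {v w : Fin n → ℤ} → v ≗ w →
  ∀ r c → replaceRow M j v r c ≡ replaceRow M j w r c
replaceRow-cong M j v≗w r c = cong (λ t → if does (r ≟ j) then t else M r c) (v≗w c)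

Event-replaceRow-respects : ∀ {n} (M : Fin n → Fin n → ℤ) j A i →
  (λ v → Event (replaceRow M j v) A i) Respects _≗_
Event-replaceRow-respects M j A i {v} {w} v≗w =
  subst₂ _≤_ (cong ℤ.∣_∣ (Per-sub-cong A)) (cong ℤ.∣_∣ (Per-sub-cong (A ∪ ⁅ i ⁆)))
  where
  Per-sub-cong : ∀ S → Per _ (sub (replaceRow M j v) S) ≡ Per _ (sub (replaceRow M j w) S)
  Per-sub-cong S = Per-cong _ (sub (replaceRow M j v) S) (sub (replaceRow M j w) S)
    λ r c → replaceRow-cong M j v≗w _ _

Event-for-some-sign : ∀ {n} (M : Fin n → Fin n → ℤ) (A : Subset n) (k<n : ∣ A ∣ < n) i → i ∉ A → ∀ x →
  Event (replaceRow M (fromℕ< k<n) (setAt x i 1ℤ)) A i ⊎ Event (replaceRow M (fromℕ< k<n) (setAt x i -1ℤ)) A i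
Event-for-some-sign {n} M A k<n i i∉A x = Sum.map (bound-by 1ℤ) (bound-by -1ℤ)
  (∣p∣≤∣a∣⊎∣p∣≤∣b∣ _ (Per _ (sub (N -1ℤ) (A ∪ ⁅ i ⁆))) (Per _ (sub M A)) (Per-flip M A k<n i i∉A x))
  where
  N : ℤ → Fin n → Fin n → ℤ
  N s = replaceRow M (fromℕ< k<n) (setAt x i s)
  bound-by : ∀ s → ℤ.∣ Per _ (sub M A) ∣ ≤ ℤ.∣ Per _ (sub (N s) (A ∪ ⁅ i ⁆)) ∣ → Event (N s) A i
  bound-by s = subst (_≤ ℤ.∣ Per _ (sub (N s) (A ∪ ⁅ i ⁆)) ∣)
    (cong ℤ.∣_∣ (sym (Per-sub-replaceRow M k<n (setAt x i s) A ℕ.≤-refl)))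

-- Counting sign vectors

signExtensions : ∀ {n} → List (Fin n → ℤ) → List (Fin (ℕ.suc n) → ℤ)
signExtensions = concatMap (λ v → (1ℤ Vector.∷ v) ∷ (-1ℤ Vector.∷ v) ∷ [])

length-signExtensions : ∀ {n} (xs : List (Fin n → ℤ)) → length (signExtensions xs) ≡ 2 * length xs
length-signExtensions []       = refl
length-signExtensions (v ∷ xs) =
  trans (cong (ℕ.suc ∘ ℕ.suc) (length-signExtensions xs)) (cong ℕ.suc (sym (ℕ.+-suc (length xs) _)))

length-signVecs : ∀ n → length (signVecs n) ≡ 2 ^ n
length-signVecs ℕ.zero    = refl
length-signVecs (ℕ.suc n) = trans (length-signExtensions (signVecs n)) (cong (2 *_) (length-signVecs n))

count-signExtensions : ∀ {n} {P : Pred (Fin (ℕ.suc n) → ℤ) 0ℓ} (P? : Decidable P) xs →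
  length (filter P? (signExtensions xs))
    ≡ length (filter (P? ∘ (1ℤ Vector.∷_)) xs) ℕ.+ length (filter (P? ∘ (-1ℤ Vector.∷_)) xs)
count-signExtensions P? [] = refl
count-signExtensions P? (v ∷ xs) with P? (1ℤ Vector.∷ v)
... | yes _ with P? (-1ℤ Vector.∷ v)
...   | yes _ = cong ℕ.suc (trans (cong ℕ.suc (count-signExtensions P? xs)) (sym (ℕ.+-suc _ _)))
...   | no  _ = cong ℕ.suc (count-signExtensions P? xs)
count-signExtensions P? (v ∷ xs) | no _ with P? (-1ℤ Vector.∷ v)
...   | yes _ = trans (cong ℕ.suc (count-signExtensions P? xs)) (sym (ℕ.+-suc _ _))
...   | no  _ = count-signExtensions P? xs

length≤count+count : ∀ {A : Set} {P Q : Pred A 0ℓ} (P? : Decidable P) (Q? : Decidable Q) →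
  (∀ x → P x ⊎ Q x) → ∀ xs → length xs ≤ length (filter P? xs) ℕ.+ length (filter Q? xs)
length≤count+count P? Q? P⊎Q []       = ℕ.z≤n
length≤count+count P? Q? P⊎Q (x ∷ xs) with P? x
... | yes _ with Q? x
...   | yes _ = ℕ.s≤s (ℕ.≤-trans (length≤count+count P? Q? P⊎Q xs)
                              (ℕ.+-monoʳ-≤ (length (filter P? xs)) (ℕ.n≤1+n _)))
...   | no  _ = ℕ.s≤s (length≤count+count P? Q? P⊎Q xs)
length≤count+count P? Q? P⊎Q (x ∷ xs) | no ¬Px with Q? x
...   | yes _ = ℕ.≤-trans (ℕ.s≤s (length≤count+count P? Q? P⊎Q xs)) (ℕ.≤-reflexive (sym (ℕ.+-suc _ _)))
...   | no ¬Qx with P⊎Q x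
...     | inj₁ Px = ⊥-elim (¬Px Px)
...     | inj₂ Qx = ⊥-elim (¬Qx Qx)

halves-sum : ∀ {m} a b → m ≤ 2 * a → m ≤ 2 * b → 2 * m ≤ 2 * (a ℕ.+ b)
halves-sum {m} a b m≤2a m≤2b =
  subst₂ _≤_ (cong (m ℕ.+_) (sym (ℕ.+-identityʳ m))) (sym (ℕ.*-distribˡ-+ 2 a b)) (ℕ.+-mono-≤ m≤2a m≤2b)

signVecs-half : ∀ n (i : Fin n) {P : Pred (Fin n → ℤ) 0ℓ} (P? : Decidable P) → P Respects _≗_ →
  (∀ x → P (setAt x i 1ℤ) ⊎ P (setAt x i -1ℤ)) → 2 ^ n ≤ 2 * length (filter P? (signVecs n))
signVecs-half (ℕ.suc n) zero {P} P? resp one-of =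
  subst₂ (λ l c → 2 * l ≤ 2 * c) (length-signVecs n) (sym (count-signExtensions P? (signVecs n)))
    (ℕ.*-monoʳ-≤ 2 (length≤count+count (P? ∘ (1ℤ Vector.∷_)) (P? ∘ (-1ℤ Vector.∷_)) one-of′ (signVecs n)))
  where
  one-of′ : ∀ v → P (1ℤ Vector.∷ v) ⊎ P (-1ℤ Vector.∷ v)
  one-of′ v with one-of (1ℤ Vector.∷ v)
  ... | inj₁ P₊ = inj₁ (resp (λ { zero → refl ; (suc c) → refl }) P₊)
  ... | inj₂ P₋ = inj₂ (resp (λ { zero → refl ; (suc c) → refl }) P₋)
signVecs-half (ℕ.suc n) (suc i) {P} P? resp one-of =
  subst (λ c → 2 * 2 ^ n ≤ 2 * c) (sym (count-signExtensions P? (signVecs n)))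
    (halves-sum (count 1ℤ) (count -1ℤ)
                (signVecs-half n i (P? ∘ (1ℤ Vector.∷_)) (resp-∷ 1ℤ) (one-of-∷ 1ℤ))
                (signVecs-half n i (P? ∘ (-1ℤ Vector.∷_)) (resp-∷ -1ℤ) (one-of-∷ -1ℤ)))
  where
  count : ℤ → ℕ
  count s = length (filter (P? ∘ (s Vector.∷_)) (signVecs n))
  resp-∷ : ∀ s → (λ v → P (s Vector.∷ v)) Respects _≗_
  resp-∷ s v≗w = resp λ { zero → refl ; (suc c) → v≗w c }
  one-of-∷ : ∀ s v → P (s Vector.∷ setAt v i 1ℤ) ⊎ P (s Vector.∷ setAt v i -1ℤ)
  one-of-∷ s v with one-of (s Vector.∷ v)
  ... | inj₁ P₊ = inj₁ (resp (λ { zero → refl ; (suc c) → refl }) P₊)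
  ... | inj₂ P₋ = inj₂ (resp (λ { zero → refl ; (suc c) → refl }) P₋)

count-pair : ∀ {A : Set} {P : Pred A 0ℓ} (P? : Decidable P) {a b} → P a ⊎ P b →
  1 ≤ length (filter P? (a ∷ b ∷ []))
count-pair P? {a} {b} Pa⊎Pb with P? a
... | yes _ = ℕ.s≤s ℕ.z≤n
... | no ¬Pa with P? b
...   | yes _  = ℕ.s≤s ℕ.z≤n
...   | no ¬Pb = ⊥-elim ([ ¬Pa , ¬Pb ] Pa⊎Pb)

lemma4p1 : (n k : ℕ) → 1 ≤ k → (k<n : k < n)
    → (M : Fin n → Fin n → ℤ) → IsSignMatrix M
    → (A : Subset n) → ∣ A ∣ ≡ k → (i : Fin n) → i ∉ A
    → (2 ^ n ≤ 2 * countEvent M (fromℕ< k<n) A i (signVecs n))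
      × ((x : Fin n → ℤ) → (∀ c → IsSign (x c))
         → 2 ≤ 2 * countEvent M (fromℕ< k<n) A i (setAt x i 1ℤ ∷ setAt x i -1ℤ ∷ []))
-- Neither 1 ≤ k nor the ±1 entries are needed: the argument works for every integer matrix.
lemma4p1 n _ _ k<n M _ A refl i i∉A =
  signVecs-half n i event-at? (Event-replaceRow-respects M row A i) (Event-for-some-sign M A k<n i i∉A) ,
  λ x _ → ℕ.*-monoʳ-≤ 2 (count-pair event-at? (Event-for-some-sign M A k<n i i∉A x))
  where
  row : Fin n
  row = fromℕ< k<n
  event-at? : Decidable (λ v → Event (replaceRow M row v) A i)
  event-at? v = event? (replaceRow M row v) A i
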